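{- There is an algorithm on a random access machine which, given $n\in\mathbb{N}$ with $n\ge1$ and a very good instruction sequence $X$ with $\mathrm{len}(X)=n$, decides in time $O(n)$ whether, for every combination of initial contents of the input registers $\mathtt{in}{:}i$ with $i\in\mathrm{iregs}(X)$, execution of $X$ yields $1$ as the final content of $\mathtt{out}$.
   Context: Basic instructions: $\mathtt{in}{:}i.\mathtt{get}$ ($i\ge1$), $\mathtt{out}.\mathtt{set}{:}b$ ($b\in\{0,1\}$), $\mathtt{aux}{:}i.\mathtt{get}$, $\mathtt{aux}{:}i.\mathtt{set}{:}b$. The part before the dot names a Boolean register ($\mathtt{in}{:}i$ input, $\mathtt{out}$ output, $\mathtt{aux}{:}i$ auxiliary); $\mathtt{get}$ changes nothing and replies the content, $\mathtt{set}{:}b$ makes the content $b$ and replies $b$. Primitive instructions: for each basic instruction $a$, plain $a$, positive test $+a$, negative test $-a$; forward jumps $\#l$ ($l\in\mathbb{N}$); termination $!$. Instruction sequences are finite sequences $X=u_1;\dots;u_k$ of primitive instructions, $\mathrm{len}(X)=k$. Execution starts at $u_1$ (with $\mathtt{out}$ initially $0$): plain $a$ executes $a$ and proceeds with the next instruction; $+a$ executes $a$ and proceeds with the next instruction if the reply is $1$, otherwise skips the next one and proceeds with the one after it; $-a$ likewise with replies reversed; $\#l$ proceeds with the $l$-th next instruction; $!$ terminates. If $l=0$ or there is no instruction to proceed with, execution never terminates (and yields no final content). Read instructions are $+\mathtt{in}{:}i.\mathtt{get}$ and $-\mathtt{in}{:}i.\mathtt{get}$; $\mathrm{iregs}(X)$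 is the set of $i$ such that $\mathtt{in}{:}i$ is read by some read instruction occurring in $X$. A good instruction sequence is one of the form $Z;\mathtt{out}.\mathtt{set}{:}1;!$ where only read instructions and forward jumps $\#l$ with $l>0$ occur in $Z$; a very good instruction sequence is a good one in which no input register name appears in more than one occurrence of a read instruction. Model: random access machine in the sense of Cook and Reckhow (without multiplication/division), uniform cost criterion; each primitive instruction of the input is represented by two integers (its form and its natural-number parameter, or $-1$ if none). -}

module Defs where

open import Data.Nat using (ℕ; zero; suc; _+_; _*_; _≡ᵇ_; NonZero)
open import Data.Bool using (Bool; true; false; if_then_else_; not)
open import Data.Integer using (ℤ; +_; -[1+_]; 0ℤ; _<?_) renaming (_+_ to _+ℤ_; _-_ to _-ℤ_)
open import Data.List using (List; []; _∷_; _++_; length; drop; reverse; concatMap)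
open import Data.List.Relation.Unary.All using (All)
open import Data.List.Relation.Unary.Unique.Propositional using (Unique)
open import Data.Maybe using (Maybe; just; nothing)
open import Data.Product using (_×_; _,_; ∃)
open import Relation.Nullary using (does)
open import Relation.Binary.PropositionalEquality using (_≡_)

data Basic : Set where
  inGet  : (i : ℕ) → .⦃ NonZero i ⦄ → Basic
  outSet : Bool → Basic
  auxGet : ℕ → Basic
  auxSet : ℕ → Bool → Basic

data Prim : Set where
  plain : Basic → Prim
  pos   : Basic → Prim
  neg   : Basic → Prim
  jmp   : ℕ → Prim
  halt  : Prim

InstrSeq : Set
InstrSeq = List Prim

-- Register state: out and aux registers (input registers are never
-- changed, they are given by an assignment ρ).
record RegState : Set where
  constructor regs
  field
    outReg : Bool
    auxReg : ℕ → Bool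
open RegState

initState : RegState
initState = regs false (λ _ → false)

update : (ℕ → Bool) → ℕ → Bool → (ℕ → Bool)
update f i b k = if k ≡ᵇ i then b else f k

doBasic : (ℕ → Bool) → Basic → RegState → RegState × Bool
doBasic ρ (inGet i)    s = s , ρ i
doBasic ρ (outSet b)   s = regs b (auxReg s) , b
doBasic ρ (auxGet i)   s = s , auxReg s i
doBasic ρ (auxSet i b) s = regs (outReg s) (update (auxReg s) i b) , b

-- Execution of the remaining instructions; 'nothing' = no termination
-- (jump #0 or no instruction to proceed with).  Every step consumes at
-- least one instruction, so fuel = length of the sequence suffices.
exec : ℕ → InstrSeq → (ℕ → Bool) → RegState → Maybe Bool
exec _       []       ρ s = nothing
exec zero    (_ ∷ _)  ρ s = nothing
exec (suc f) (plain a ∷ us) ρ s with doBasic ρ a s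
... | s' , _ = exec f us ρ s'
exec (suc f) (pos a ∷ us) ρ s with doBasic ρ a s
... | s' , true  = exec f us ρ s'
... | s' , false = exec f (drop 1 us) ρ s'
exec (suc f) (neg a ∷ us) ρ s with doBasic ρ a s
... | s' , false = exec f us ρ s'
... | s' , true  = exec f (drop 1 us) ρ s'
exec (suc f) (jmp zero ∷ us)    ρ s = nothing
exec (suc f) (jmp (suc l) ∷ us) ρ s = exec f (drop l us) ρ s
exec (suc f) (halt ∷ us)        ρ s = just (outReg s)

run : InstrSeq → (ℕ → Bool) → Maybe Bool
run X ρ = exec (length X) X ρ initState

readRegs : InstrSeq → List ℕ
readRegs []                  = []
readRegs (pos (inGet i) ∷ us) = i ∷ readRegs us
readRegs (neg (inGet i) ∷ us) = i ∷ readRegs us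
readRegs (_ ∷ us)             = readRegs us

data ReadOrJump : Prim → Set where
  rdPos : (i : ℕ) → .⦃ _ : NonZero i ⦄ → ReadOrJump (pos (inGet i))
  rdNeg : (i : ℕ) → .⦃ _ : NonZero i ⦄ → ReadOrJump (neg (inGet i))
  jmpPos : (l : ℕ) → ReadOrJump (jmp (suc l))

Good : InstrSeq → Set
Good X = ∃ λ (Z : InstrSeq) → All ReadOrJump Z × X ≡ Z ++ (plain (outSet true) ∷ halt ∷ [])

VeryGood : InstrSeq → Set
VeryGood X = Good X × Unique (readRegs X)

AlwaysOne : InstrSeq → Set
AlwaysOne X = (ρ : ℕ → Bool) → run X ρ ≡ just true

minusOne : ℤ
minusOne = -[1+ 0 ]

basicForm : Basic → ℕ
basicForm (inGet _)        = 0
basicForm (outSet false)   = 1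
basicForm (outSet true)    = 2
basicForm (auxGet _)       = 3
basicForm (auxSet _ false) = 4
basicForm (auxSet _ true)  = 5

basicParam : Basic → ℤ
basicParam (inGet i)    = + i
basicParam (outSet _)   = minusOne
basicParam (auxGet i)   = + i
basicParam (auxSet i _) = + i

encodePrim : Prim → List ℤ
encodePrim (plain a) = + (basicForm a) ∷ basicParam a ∷ []
encodePrim (pos a)   = + (6 + basicForm a) ∷ basicParam a ∷ []
encodePrim (neg a)   = + (12 + basicForm a) ∷ basicParam a ∷ []
encodePrim (jmp l)   = + 18 ∷ + l ∷ []
encodePrim halt      = + 19 ∷ minusOne ∷ []

encodeIS : InstrSeq → List ℤ
encodeIS = concatMap encodePrim

-- Random access machines (Cook & Reckhow 1973), uniform cost

data RInstr : Set where
  load   : ℕ → ℤ → RInstr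
  add    : ℕ → ℕ → ℕ → RInstr
  sub    : ℕ → ℕ → ℕ → RInstr
  iload  : ℕ → ℕ → RInstr
  istore : ℕ → ℕ → RInstr
  tra    : ℕ → ℕ → RInstr
  read   : ℕ → RInstr
  print  : ℕ → RInstr

Program : Set
Program = List RInstr

record Running : Set where
  constructor cfg
  field
    pc     : ℕ
    mem    : ℕ → ℤ
    input  : List ℤ
    outRev : List ℤ      -- output printed so far, most recent first

data Config : Set where
  running : Running → Config
  halted  : List ℤ → Config
  crashed : Config

nth : {A : Set} → List A → ℕ → Maybe A
nth []       _       = nothing
nth (x ∷ xs) zero    = just x
nth (x ∷ xs) (suc k) = nth xs k

setMem : (ℕ → ℤ) → ℕ → ℤ → (ℕ → ℤ)
setMem m i v k = if k ≡ᵇ i then v else m k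

stepI : RInstr → Running → Config
stepI (load i c) (cfg p m inp o) = running (cfg (suc p) (setMem m i c) inp o)
stepI (add i j k) (cfg p m inp o) = running (cfg (suc p) (setMem m i (m j +ℤ m k)) inp o)
stepI (sub i j k) (cfg p m inp o) = running (cfg (suc p) (setMem m i (m j -ℤ m k)) inp o)
stepI (iload i j) (cfg p m inp o) with m j
... | + a    = running (cfg (suc p) (setMem m i (m a)) inp o)
... | -[1+ _ ] = crashed
stepI (istore i j) (cfg p m inp o) with m i
... | + a    = running (cfg (suc p) (setMem m a (m j)) inp o)
... | -[1+ _ ] = crashed
stepI (tra t j) (cfg p m inp o) =
  if does (0ℤ <? m j) then running (cfg t m inp o) else running (cfg (suc p) m inp o)
stepI (read i) (cfg p m []        o) = crashed
stepI (read i) (cfg p m (v ∷ inp) o) = running (cfg (suc p) (setMem m i v) inp o)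
stepI (print i) (cfg p m inp o) = running (cfg (suc p) m inp (m i ∷ o))

step : Program → Config → Config
step P (running c) with nth P (Running.pc c)
... | just ins = stepI ins c
... | nothing  = halted (reverse (Running.outRev c))
step P (halted o) = halted o
step P crashed    = crashed

-- Configuration after t steps (uniform cost: each step costs 1).
steps : Program → ℕ → Config → Config
steps P zero    c = c
steps P (suc t) c = steps P t (step P c)

initConfig : List ℤ → Config
initConfig inp = running (cfg 0 (λ _ → 0ℤ) inp [])

HaltsWithin : Program → List ℤ → ℕ → List ℤ → Set
HaltsWithin P inp t o = steps P t (initConfig inp) ≡ halted o

-- Call a position of X successful if every execution started there ends with out = 1. An out.set:1
-- (followed by !) is successful, a ! or a position past the end is not, a jump #l is successful iff
-- the position l further on is, and a test +in:i.get or -in:i.get is successful iff both of its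
-- continuations are. Only the last clause needs very-goodness: in:i is read nowhere else, so its value
-- can be chosen to steer the test into a failing continuation without disturbing that continuation.
-- These verdicts are computed right to left over an array, which a RAM fills in one pass over X and
-- overwrites with verdicts in a second pass, spending at most 20 steps per instruction in each.
module Submission where

open import Defs
open import Algebra.Properties.CommutativeSemigroup using (x∙yz≈y∙xz)
open import Data.Bool using (Bool; true; false; if_then_else_; not; _∧_; T)
open import Data.Bool.Properties using (∧-conicalˡ; ∧-conicalʳ)
open import Data.Integer using (ℤ; +_; 0ℤ; _<?_) renaming (_+_ to _+ℤ_; _-_ to _-ℤ_)
open import Data.List using (List; []; _∷_; _++_; length; drop; map; reverse; _ʳ++_)
open import Data.List.Properties using (length-drop; length-++; length-reverse; ʳ++-ʳ++; ʳ++-defn; ++-assoc)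
open import Data.List.Relation.Unary.All as All using (All; []; _∷_)
import Data.List.Relation.Unary.All.Properties as All
open import Data.List.Relation.Unary.AllPairs using (_∷_)
open import Data.List.Relation.Unary.Unique.Propositional using (Unique)
import Data.List.Relation.Unary.Unique.Propositional.Properties as Unique
open import Data.Maybe using (just)
open import Data.Nat using (ℕ; zero; suc; _+_; _*_; _∸_; _≤_; _≡ᵇ_; _≤?_; s≤s)
open import Data.Nat.Properties
  using (≤-refl; ≤-trans; +-mono-≤; m≤m+n; m∸n≤m; m+[n∸m]≡n; +-assoc; +-identityʳ; +-comm; ≡ᵇ⇒≡;
         +-commutativeSemigroup; module ≤-Reasoning)
open import Data.Nat.Tactic.RingSolver using (solve-∀)
open import Data.Product using (∃; ∃₂; Σ; _×_; _,_)
open import Function using (const)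
open import Function.Bundles using (_⇔_; mk⇔)
open import Relation.Nullary using (does; contradiction)
open import Relation.Nullary.Decidable using (True; toWitness)
open import Relation.Binary.PropositionalEquality
  using (_≡_; _≢_; refl; sym; trans; cong; cong₂; subst; subst₂; ≢-sym; module ≡-Reasoning)

at : {A : Set} → A → List A → ℕ → A
at d []       _       = d
at d (x ∷ xs) zero    = x
at d (x ∷ xs) (suc k) = at d xs k

at-drop : ∀ {A : Set} (d : A) k xs j → at d (drop k xs) j ≡ at d xs (k + j)
at-drop d zero    xs       j = refl
at-drop d (suc k) []       j = refl
at-drop d (suc k) (x ∷ xs) j = at-drop d k xs j

at-map : ∀ {A B : Set} (f : A → B) d xs k → at (f d) (map f xs) k ≡ f (at d xs k)
at-map f d []       k       = refl
at-map f d (x ∷ xs) zero    = refl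
at-map f d (x ∷ xs) (suc k) = at-map f d xs k

at-++ : ∀ {A : Set} (d : A) xs ys {n} → length xs ≡ n → ∀ k → at d (xs ++ ys) (n + k) ≡ at d ys k
at-++ d []       ys refl k = refl
at-++ d (x ∷ xs) ys refl k = at-++ d xs ys refl k

at-++-pad : ∀ {A : Set} (d : A) xs j → at d (xs ++ d ∷ []) j ≡ at d xs j
at-++-pad d []       zero    = refl
at-++-pad d []       (suc j) = refl
at-++-pad d (x ∷ xs) zero    = refl
at-++-pad d (x ∷ xs) (suc j) = at-++-pad d xs j

at-++-write : ∀ {A : Set} (d : A) xs x y ys {n} → length xs ≡ n →
              ∀ j → (if j ≡ᵇ n then y else at d (xs ++ x ∷ ys) j) ≡ at d (xs ++ y ∷ ys) j
at-++-write d []       x y ys refl zero    = refl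
at-++-write d []       x y ys refl (suc j) = refl
at-++-write d (z ∷ xs) x y ys refl zero    = refl
at-++-write d (z ∷ xs) x y ys refl (suc j) = at-++-write d xs x y ys refl j

epilogue : InstrSeq
epilogue = plain (outSet true) ∷ halt ∷ []

verdictOf : Prim → List Bool → Bool
verdictOf (pos (inGet _))       vs = at false vs 0 ∧ at false vs 1
verdictOf (neg (inGet _))       vs = at false vs 0 ∧ at false vs 1
verdictOf (jmp (suc l))         vs = at false vs l
verdictOf (plain (outSet true)) vs = true
verdictOf _                     vs = false

verdicts : InstrSeq → List Bool
verdicts []       = []
verdicts (u ∷ us) = verdictOf u (verdicts us) ∷ verdicts us

verdict : InstrSeq → Bool
verdict us = at false (verdicts us) 0

verdicts-drop : ∀ k us → verdicts (drop k us) ≡ drop k (verdicts us)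
verdicts-drop zero    us       = refl
verdicts-drop (suc k) []       = refl
verdicts-drop (suc k) (u ∷ us) = verdicts-drop k us

verdict-drop : ∀ k us → verdict (drop k us) ≡ at false (verdicts us) k
verdict-drop k us = begin
  at false (verdicts (drop k us)) 0 ≡⟨ cong (λ vs → at false vs 0) (verdicts-drop k us) ⟩
  at false (drop k (verdicts us)) 0 ≡⟨ at-drop false k (verdicts us) 0 ⟩
  at false (verdicts us) (k + 0)    ≡⟨ cong (at false (verdicts us)) (+-identityʳ k) ⟩
  at false (verdicts us) k          ∎
  where open ≡-Reasoning

data GoodSuffix : InstrSeq → Set where
  []           : GoodSuffix []
  halt∷[]      : GoodSuffix (halt ∷ [])
  set1∷halt∷[] : GoodSuffix epilogue
  _∷_          : ∀ {u us} → ReadOrJump u → GoodSuffix us → GoodSuffix (u ∷ us)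

GoodSuffix-tail : ∀ {u us} → GoodSuffix (u ∷ us) → GoodSuffix us
GoodSuffix-tail halt∷[]      = []
GoodSuffix-tail set1∷halt∷[] = halt∷[]
GoodSuffix-tail (r ∷ g)      = g

GoodSuffix-drop : ∀ k {us} → GoodSuffix us → GoodSuffix (drop k us)
GoodSuffix-drop zero    g = g
GoodSuffix-drop (suc k) {[]}    g = g
GoodSuffix-drop (suc k) {_ ∷ _} g = GoodSuffix-drop k (GoodSuffix-tail g)

Good⇒GoodSuffix : ∀ {X} → Good X → GoodSuffix X
Good⇒GoodSuffix (Z , rj , refl) = go rj
  where
    go : ∀ {Z} → All ReadOrJump Z → GoodSuffix (Z ++ epilogue)
    go []       = set1∷halt∷[]
    go (r ∷ rj) = r ∷ go rj

module _ {P : List ℕ → Set} (P-tail : ∀ {xs} → P xs → P (drop 1 xs)) where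

  private
    readRegs-tail⁺ : ∀ {u us} → GoodSuffix (u ∷ us) → P (readRegs (u ∷ us)) → P (readRegs us)
    readRegs-tail⁺ halt∷[]        p = p
    readRegs-tail⁺ set1∷halt∷[]   p = p
    readRegs-tail⁺ (rdPos i  ∷ g) p = P-tail p
    readRegs-tail⁺ (rdNeg i  ∷ g) p = P-tail p
    readRegs-tail⁺ (jmpPos l ∷ g) p = p

  readRegs-drop⁺ : ∀ k {us} → GoodSuffix us → P (readRegs us) → P (readRegs (drop k us))
  readRegs-drop⁺ zero            g p = p
  readRegs-drop⁺ (suc k) {[]}    g p = p
  readRegs-drop⁺ (suc k) {_ ∷ _} g p = readRegs-drop⁺ k (GoodSuffix-tail g) (readRegs-tail⁺ g p)

Unique-readRegs-drop : ∀ k {us} → GoodSuffix us → Unique (readRegs us) → Unique (readRegs (drop k us))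
Unique-readRegs-drop = readRegs-drop⁺ {P = Unique} (Unique.drop⁺ 1)

All-readRegs-drop : ∀ {Q : ℕ → Set} k {us} → GoodSuffix us → All Q (readRegs us) → All Q (readRegs (drop k us))
All-readRegs-drop {Q} = readRegs-drop⁺ {P = All Q} (All.drop⁺ 1)

testSkip : (polarity reply : Bool) → ℕ
testSkip true  reply = if reply then 0 else 1
testSkip false reply = if reply then 1 else 0

skip : ∀ {u} → ReadOrJump u → (ℕ → Bool) → ℕ
skip (rdPos i)  ρ = testSkip true  (ρ i)
skip (rdNeg i)  ρ = testSkip false (ρ i)
skip (jmpPos l) ρ = l

exec-skip : ∀ f {u} (r : ReadOrJump u) us ρ s → exec (suc f) (u ∷ us) ρ s ≡ exec f (drop (skip r ρ) us) ρ s
exec-skip f (rdPos i) us ρ s with ρ i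
... | true  = refl
... | false = refl
exec-skip f (rdNeg i) us ρ s with ρ i
... | true  = refl
... | false = refl
exec-skip f (jmpPos l) us ρ s = refl

verdict-skip : ∀ {u us} (r : ReadOrJump u) ρ → verdict (u ∷ us) ≡ true → verdict (drop (skip r ρ) us) ≡ true
verdict-skip {us = us} r ρ ok = trans (verdict-drop (skip r ρ) us) (go r ok)
  where
    both : ∀ p b {vs} → at false vs 0 ∧ at false vs 1 ≡ true → at false vs (testSkip p b) ≡ true
    both true  true  ok = ∧-conicalˡ _ _ ok
    both true  false ok = ∧-conicalʳ _ _ ok
    both false true  ok = ∧-conicalʳ _ _ ok
    both false false ok = ∧-conicalˡ _ _ ok
    go : ∀ {u} (r : ReadOrJump u) → verdictOf u (verdicts us) ≡ true → at false (verdicts us) (skip r ρ) ≡ true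
    go (rdPos i)  = both true  (ρ i) {verdicts us}
    go (rdNeg i)  = both false (ρ i) {verdicts us}
    go (jmpPos l) ok = ok

verdict-sound : ∀ f {us} → GoodSuffix us → length us ≤ f → verdict us ≡ true → ∀ ρ s → exec f us ρ s ≡ just true
verdict-sound (suc (suc f)) set1∷halt∷[] _ _ ρ s = refl
verdict-sound (suc zero) set1∷halt∷[] (s≤s ()) _ ρ s
verdict-sound (suc f) {u ∷ us} (r ∷ g) (s≤s us≤f) ok ρ s = begin
  exec (suc f) (u ∷ us) ρ s          ≡⟨ exec-skip f r us ρ s ⟩
  exec f (drop (skip r ρ) us) ρ s    ≡⟨ verdict-sound f (GoodSuffix-drop k g) (≤-trans (length-drop≤ k us) us≤f)
                                                      (verdict-skip r ρ ok) ρ s ⟩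
  just true                          ∎
  where open ≡-Reasoning
        k = skip r ρ
        length-drop≤ : ∀ k (us : InstrSeq) → length (drop k us) ≤ length us
        length-drop≤ k us = subst (_≤ length us) (sym (length-drop k us)) (m∸n≤m (length us) k)

≡ᵇ-refl : ∀ n → (n ≡ᵇ n) ≡ true
≡ᵇ-refl zero    = refl
≡ᵇ-refl (suc n) = ≡ᵇ-refl n

≢⇒≡ᵇ-false : ∀ {m n} → m ≢ n → (m ≡ᵇ n) ≡ false
≢⇒≡ᵇ-false {m} {n} m≢n with m ≡ᵇ n in e
... | true  = contradiction (≡ᵇ⇒≡ m n (subst T (sym e) _)) m≢n
... | false = refl

update-self : ∀ (ρ : ℕ → Bool) i b → update ρ i b i ≡ b
update-self ρ i b rewrite ≡ᵇ-refl i = refl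

update-other : ∀ (ρ : ℕ → Bool) {i j} b → i ≢ j → update ρ i b j ≡ ρ j
update-other ρ b i≢j rewrite ≢⇒≡ᵇ-false (≢-sym i≢j) = refl

skip-cong : ∀ {u us ρ ρ′} (r : ReadOrJump u) → All (λ i → ρ i ≡ ρ′ i) (readRegs (u ∷ us)) → skip r ρ ≡ skip r ρ′
skip-cong (rdPos i)  (e ∷ _) = cong (testSkip true)  e
skip-cong (rdNeg i)  (e ∷ _) = cong (testSkip false) e
skip-cong (jmpPos l) _       = refl

exec-cong : ∀ f {us} ρ ρ′ → GoodSuffix us → All (λ i → ρ i ≡ ρ′ i) (readRegs us) →
            ∀ s → exec f us ρ s ≡ exec f us ρ′ s
exec-cong zero    {[]}    ρ ρ′ _            _ s = refl
exec-cong zero    {_ ∷ _} ρ ρ′ _            _ s = refl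
exec-cong (suc f)         ρ ρ′ []           _ s = refl
exec-cong (suc f)         ρ ρ′ halt∷[]      _ s = refl
exec-cong (suc zero)      ρ ρ′ set1∷halt∷[] _ s = refl
exec-cong (suc (suc f))   ρ ρ′ set1∷halt∷[] _ s = refl
exec-cong (suc f) {u ∷ us} ρ ρ′ (r ∷ g) agree s = begin
  exec (suc f) (u ∷ us) ρ s           ≡⟨ exec-skip f r us ρ s ⟩
  exec f (drop (skip r ρ) us) ρ s     ≡⟨ cong (λ k → exec f (drop k us) ρ s) (skip-cong r agree) ⟩
  exec f (drop (skip r ρ′) us) ρ s    ≡⟨ exec-cong f ρ ρ′ (GoodSuffix-drop (skip r ρ′) g) agree′ s ⟩
  exec f (drop (skip r ρ′) us) ρ′ s   ≡⟨ exec-skip f r us ρ′ s ⟨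
  exec (suc f) (u ∷ us) ρ′ s          ∎
  where
    open ≡-Reasoning
    agree′ = All-readRegs-drop (suc (skip r ρ′)) (r ∷ g) agree

Counterexample : ℕ → InstrSeq → Set
Counterexample f us = ∃ λ ρ → exec f us ρ initState ≢ just true

forced-failure : ∀ f {u us} (r : ReadOrJump u) {i} p b → (∀ ρ → skip r ρ ≡ testSkip p (ρ i)) →
                 GoodSuffix us → All (i ≢_) (readRegs us) →
                 Counterexample f (drop (testSkip p b) us) → Counterexample (suc f) (u ∷ us)
forced-failure f {u} {us} r {i} p b skip≡ g fresh (ρ , fails) = ρ₁ , λ succeeds → fails (begin
  exec f (drop k us) ρ initState              ≡⟨ exec-cong f ρ ρ₁ (GoodSuffix-drop k g) agree initState ⟩
  exec f (drop k us) ρ₁ initState             ≡⟨ cong (λ v → exec f (drop (testSkip p v) us) ρ₁ initState) (update-self ρ i b) ⟨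
  exec f (drop (testSkip p (ρ₁ i)) us) ρ₁ initState ≡⟨ cong (λ k → exec f (drop k us) ρ₁ initState) (skip≡ ρ₁) ⟨
  exec f (drop (skip r ρ₁) us) ρ₁ initState   ≡⟨ exec-skip f r us ρ₁ initState ⟨
  exec (suc f) (u ∷ us) ρ₁ initState          ≡⟨ succeeds ⟩
  just true                                   ∎)
  where
    open ≡-Reasoning
    k  = testSkip p b
    ρ₁ = update ρ i b
    agree : All (λ j → ρ j ≡ ρ₁ j) (readRegs (drop k us))
    agree = All.map (λ i≢j → sym (update-other ρ b i≢j)) (All-readRegs-drop k g fresh)

failing-branch : ∀ p vs → at false vs 0 ∧ at false vs 1 ≡ false → ∃ λ b → at false vs (testSkip p b) ≡ false
failing-branch p vs bad with at false vs 0 in e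
... | false = p     , trans (cong (at false vs) (testSkip-same p)) e
  where testSkip-same : ∀ p → testSkip p p ≡ 0
        testSkip-same true  = refl
        testSkip-same false = refl
... | true  = not p , trans (cong (at false vs) (testSkip-flip p)) bad
  where testSkip-flip : ∀ p → testSkip p (not p) ≡ 1
        testSkip-flip true  = refl
        testSkip-flip false = refl

verdict-complete : ∀ f {us} → GoodSuffix us → Unique (readRegs us) → verdict us ≡ false → Counterexample f us
verdict-complete zero    {[]}    _       _ _ = const false , λ ()
verdict-complete zero    {_ ∷ _} _       _ _ = const false , λ ()
verdict-complete (suc f)         []      _ _ = const false , λ ()
verdict-complete (suc f)         halt∷[] _ _ = const false , λ ()
verdict-complete (suc f) {u ∷ us} (r ∷ g) uniq bad = through r uniq bad
  where
    rest : ∀ k → at false (verdicts us) k ≡ false → Counterexample f (drop k us)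
    rest k bad-k = verdict-complete f (GoodSuffix-drop k g) (Unique-readRegs-drop (suc k) (r ∷ g) uniq)
                                    (trans (verdict-drop k us) bad-k)
    through : ∀ {u} (r : ReadOrJump u) → Unique (readRegs (u ∷ us)) → verdictOf u (verdicts us) ≡ false →
           Counterexample (suc f) (u ∷ us)
    through (rdPos i) (fresh ∷ _) bad =
      let b , bad-b = failing-branch true (verdicts us) bad
      in forced-failure f (rdPos i) true b (λ _ → refl) g fresh (rest _ bad-b)
    through (rdNeg i) (fresh ∷ _) bad =
      let b , bad-b = failing-branch false (verdicts us) bad
      in forced-failure f (rdNeg i) false b (λ _ → refl) g fresh (rest _ bad-b)
    through (jmpPos l) _ bad = rest l bad

verdict⇔AlwaysOne : ∀ {X} → VeryGood X → verdict X ≡ true ⇔ AlwaysOne X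
verdict⇔AlwaysOne {X} (good , uniq) = mk⇔ (λ ok ρ → verdict-sound (length X) g ≤-refl ok ρ initState) complete
  where
    g = Good⇒GoodSuffix good
    complete : AlwaysOne X → verdict X ≡ true
    complete always with verdict X in e
    ... | true  = refl
    ... | false with verdict-complete (length X) g uniq e
    ...   | ρ , fails = contradiction (always ρ) fails

base : ℕ
base = 20

-- Cells past the end of the list read as 0, which is both the initial memory content and the
-- encoding of the verdict false of positions past the end of X.
Holds : (ℕ → ℤ) → List ℤ → Set
Holds m xs = ∀ j → m (base + j) ≡ at (+ 0) xs j

module _ (m : ℕ → ℤ) (A : List ℤ) where

  private
    at-ʳ++ : ∀ E j → at (+ 0) (A ʳ++ E) j ≡ at (+ 0) (reverse A ++ E) j
    at-ʳ++ E j = cong (λ L → at (+ 0) L j) (ʳ++-defn A)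

  Holds-read : ∀ {E} → Holds m (A ʳ++ E) → ∀ k {n} → n ≡ length A + k → m (base + n) ≡ at (+ 0) E k
  Holds-read {E} h k refl = begin
    m (base + (length A + k))                ≡⟨ trans (h _) (at-ʳ++ E _) ⟩
    at (+ 0) (reverse A ++ E) (length A + k) ≡⟨ at-++ (+ 0) (reverse A) E (length-reverse A) k ⟩
    at (+ 0) E k                             ∎
    where open ≡-Reasoning

  Holds-write : ∀ {x E} y → Holds m (A ʳ++ x ∷ E) → Holds (setMem m (base + length A) y) (A ʳ++ y ∷ E)
  Holds-write {x} {E} y h j = begin
    (if j ≡ᵇ length A then y else m (base + j))                    ≡⟨ cong (if j ≡ᵇ length A then y else_) (trans (h j) (at-ʳ++ _ j)) ⟩
    (if j ≡ᵇ length A then y else at (+ 0) (reverse A ++ x ∷ E) j) ≡⟨ at-++-write (+ 0) (reverse A) x y E (length-reverse A) j ⟩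
    at (+ 0) (reverse A ++ y ∷ E) j                                ≡⟨ at-ʳ++ _ j ⟨
    at (+ 0) (A ʳ++ y ∷ E) j                                       ∎
    where open ≡-Reasoning

  Holds-pad : ∀ {E} → Holds m (A ʳ++ E) → Holds m (A ʳ++ E ++ + 0 ∷ [])
  Holds-pad {E} h j = begin
    m (base + j)                            ≡⟨ trans (h j) (at-ʳ++ E j) ⟩
    at (+ 0) (reverse A ++ E) j             ≡⟨ at-++-pad (+ 0) (reverse A ++ E) j ⟨
    at (+ 0) ((reverse A ++ E) ++ + 0 ∷ []) j ≡⟨ cong (λ L → at (+ 0) L j) (++-assoc (reverse A) E (+ 0 ∷ [])) ⟩
    at (+ 0) (reverse A ++ E ++ + 0 ∷ []) j ≡⟨ at-ʳ++ _ j ⟨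
    at (+ 0) (A ʳ++ E ++ + 0 ∷ []) j        ∎
    where open ≡-Reasoning

module Trace (P : Program) where

  infixr 4 _▸_
  data Run : Config → Config → ℕ → Set where
    done : ∀ {c} → Run c c 0
    _▸_  : ∀ {c c₁ c′ k} → step P c ≡ c₁ → Run c₁ c′ k → Run c c′ (suc k)

  Run-trans : ∀ {c c₁ c₂ a b} → Run c c₁ a → Run c₁ c₂ b → Run c c₂ (a + b)
  Run-trans done      r′ = r′
  Run-trans (e ▸ r) r′ = e ▸ Run-trans r r′

  Run⇒steps : ∀ {c c′ k} → Run c c′ k → steps P k c ≡ c′
  Run⇒steps done            = refl
  Run⇒steps {k = suc k} (e ▸ r) = trans (cong (steps P k) e) (Run⇒steps r)

  Reach : Config → Config → ℕ → Set
  Reach c c′ b = Σ ℕ λ k → Run c c′ k × k ≤ b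

  Reach-trans : ∀ {c c₁ c₂ a b} → Reach c c₁ a → Reach c₁ c₂ b → Reach c c₂ (a + b)
  Reach-trans (k , r , k≤a) (k′ , r′ , k′≤b) = k + k′ , Run-trans r r′ , +-mono-≤ k≤a k′≤b

  steps-+ : ∀ k k′ c → steps P (k + k′) c ≡ steps P k′ (steps P k c)
  steps-+ zero    k′ c = refl
  steps-+ (suc k) k′ c = steps-+ k k′ (step P c)

  steps-halted : ∀ k o → steps P k (halted o) ≡ halted o
  steps-halted zero    o = refl
  steps-halted (suc k) o = steps-halted k o

  Reach⇒HaltsWithin : ∀ {inp o b t} → Reach (initConfig inp) (halted o) b → b ≤ t → HaltsWithin P inp t o
  Reach⇒HaltsWithin {inp} {o} {t = t} (k , r , k≤b) b≤t = begin
    steps P t c                   ≡⟨ cong (λ n → steps P n c) (m+[n∸m]≡n k≤t) ⟨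
    steps P (k + (t ∸ k)) c       ≡⟨ steps-+ k (t ∸ k) c ⟩
    steps P (t ∸ k) (steps P k c) ≡⟨ cong (steps P (t ∸ k)) (Run⇒steps r) ⟩
    steps P (t ∸ k) (halted o)    ≡⟨ steps-halted (t ∸ k) o ⟩
    halted o                      ∎
    where open ≡-Reasoning
          c = initConfig inp
          k≤t = ≤-trans k≤b b≤t

tra-taken : ∀ {A : Set} {z v} {x y : A} → z ≡ v → does (0ℤ <? v) ≡ true → (if does (0ℤ <? z) then x else y) ≡ x
tra-taken refl v>0 rewrite v>0 = refl

tra-not-taken : ∀ {A : Set} {z v} {x y : A} → z ≡ v → does (0ℤ <? v) ≡ false → (if does (0ℤ <? z) then x else y) ≡ y
tra-not-taken refl v≤0 rewrite v≤0 = refl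

iload-at : ∀ {i j pc m inp o a} → m j ≡ + a → stepI (iload i j) (cfg pc m inp o) ≡ running (cfg (suc pc) (setMem m i (m a)) inp o)
iload-at {j = j} {m = m} e with m j
iload-at refl | .(+ _) = refl

istore-at : ∀ {i j pc m inp o a} → m i ≡ + a → stepI (istore i j) (cfg pc m inp o) ≡ running (cfg (suc pc) (setMem m a (m j)) inp o)
istore-at {i = i} {m = m} e with m i
istore-at refl | .(+ _) = refl

count ptr word arg tmp val : ℕ
count = 1
ptr   = 2
word  = 3
arg   = 4
tmp   = 5
val   = 6

-- Cells base, base + 1, … first receive code u (the jump length, 0 for a read; jumps in Z are
-- positive) for each u of Z and then 1 for out.set:1 (pc 2–25); count instructions of Z are
-- stored and ptr = base + count. Then ptr moves back and each code is replaced by the encoded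
-- verdict of its position (pc 9, 26–44); finally the cell at base is printed (pc 10–13).
decider : Program
decider =
  load ptr (+ base) ∷ read word ∷
  read word ∷ read arg ∷ load tmp (+ 2) ∷ sub tmp word tmp ∷ tra 14 tmp ∷
  load tmp (+ 1) ∷ istore ptr tmp ∷
  tra 26 count ∷ iload val ptr ∷ print val ∷ load tmp (+ 1) ∷ tra 100 tmp ∷
  load tmp (+ 18) ∷ sub tmp tmp word ∷ tra 20 tmp ∷ istore ptr arg ∷ load tmp (+ 1) ∷ tra 22 tmp ∷
  load tmp (+ 0) ∷ istore ptr tmp ∷
  load tmp (+ 1) ∷ add ptr tmp ptr ∷ add count tmp count ∷ tra 2 tmp ∷
  load tmp (+ 1) ∷ sub ptr ptr tmp ∷ sub count count tmp ∷ iload word ptr ∷ tra 40 word ∷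
  load tmp (+ 1) ∷ add tmp tmp ptr ∷ iload val tmp ∷ tra 36 val ∷ tra 42 tmp ∷
  load tmp (+ 2) ∷ add tmp tmp ptr ∷ iload val tmp ∷ tra 42 tmp ∷
  add tmp word ptr ∷ iload val tmp ∷
  istore ptr val ∷ load tmp (+ 1) ∷ tra 9 tmp ∷ []

open Trace decider

code : Prim → ℤ
code (jmp l) = + l
code _       = + 0

enc : Bool → ℤ
enc b = if b then + 1 else + 0

record Layout (A E : List ℤ) (m : ℕ → ℤ) : Set where
  constructor layout
  field
    count-at : m count ≡ + length A
    ptr-at   : m ptr ≡ + (base + length A)
    contents : Holds m (A ʳ++ E)

≤! : ∀ {a b} {a≤?b : True (a ≤? b)} → a ≤ b
≤! {a≤?b = a≤?b} = toWitness a≤?b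

read-instr : ∀ {u} → ReadOrJump u → ∀ Zs Zr m → Layout (map code Zr) [] m →
             ∃ λ m′ → Reach (running (cfg 2 m (encodeIS ((u ∷ Zs) ++ epilogue)) []))
                            (running (cfg 2 m′ (encodeIS (Zs ++ epilogue)) [])) 20
                      × Layout (map code (u ∷ Zr)) [] m′
read-instr (rdPos i) Zs Zr m (layout c p h) =
  _ , (_ , (refl ▸ refl ▸ refl ▸ refl ▸ refl ▸ refl ▸ refl ▸ refl ▸ refl ▸
             istore-at {i = ptr} p ▸ refl ▸ refl ▸ refl ▸ refl ▸ done) , ≤!) ,
  layout (cong (+ 1 +ℤ_) c) (cong (+ 1 +ℤ_) p) (Holds-write m (map code Zr) _ (Holds-pad m (map code Zr) h))
read-instr (rdNeg i) Zs Zr m (layout c p h) =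
  _ , (_ , (refl ▸ refl ▸ refl ▸ refl ▸ refl ▸ refl ▸ refl ▸ refl ▸ refl ▸
             istore-at {i = ptr} p ▸ refl ▸ refl ▸ refl ▸ refl ▸ done) , ≤!) ,
  layout (cong (+ 1 +ℤ_) c) (cong (+ 1 +ℤ_) p) (Holds-write m (map code Zr) _ (Holds-pad m (map code Zr) h))
read-instr (jmpPos l) Zs Zr m (layout c p h) =
  _ , (_ , (refl ▸ refl ▸ refl ▸ refl ▸ refl ▸ refl ▸ refl ▸ refl ▸
             istore-at {i = ptr} p ▸ refl ▸ refl ▸ refl ▸ refl ▸ refl ▸ refl ▸ done) , ≤!) ,
  layout (cong (+ 1 +ℤ_) c) (cong (+ 1 +ℤ_) p) (Holds-write m (map code Zr) _ (Holds-pad m (map code Zr) h))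

haltCode : List ℤ
haltCode = encodeIS (halt ∷ [])

read-epilogue : ∀ A m → Layout A [] m →
                ∃ λ m′ → Reach (running (cfg 2 m (encodeIS epilogue) [])) (running (cfg 9 m′ haltCode [])) 7
                         × Layout A (map enc (verdicts epilogue)) m′
read-epilogue A m (layout c p h) =
  _ , (_ , (refl ▸ refl ▸ refl ▸ refl ▸ refl ▸ refl ▸ istore-at {i = ptr} p ▸ done) , ≤!) ,
  layout c p (Holds-pad (setMem m (base + length A) (+ 1)) A (Holds-write m A (+ 1) (Holds-pad m A h)))

read-phase : ∀ Zs → All ReadOrJump Zs → ∀ Zr m → Layout (map code Zr) [] m →
             ∃ λ m′ → Reach (running (cfg 2 m (encodeIS (Zs ++ epilogue)) [])) (running (cfg 9 m′ haltCode []))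
                              (length Zs * 20 + 7)
                      × Layout (map code (Zs ʳ++ Zr)) (map enc (verdicts epilogue)) m′
read-phase []       []       Zr m L = read-epilogue (map code Zr) m L
read-phase (u ∷ Zs) (r ∷ rs) Zr m L =
  let m₁ , reach₁ , L₁ = read-instr r Zs Zr m L
      m₂ , reach₂ , L₂ = read-phase Zs rs (u ∷ Zr) m₁ L₁
  in m₂ , subst (Reach _ _) (sym (+-assoc 20 (length Zs * 20) 7)) (Reach-trans reach₁ reach₂) , L₂

DpStep : Prim → List Prim → List Bool → (ℕ → ℤ) → Set
DpStep u Zr vs m = ∃ λ m′ → Reach (running (cfg 9 m haltCode [])) (running (cfg 9 m′ haltCode [])) 20
                            × Layout (map code Zr) (map enc (verdictOf u vs ∷ vs)) m′

module _ {u} (Zr : List Prim) (vs : List Bool) (m : ℕ → ℤ)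
         (L : Layout (map code (u ∷ Zr)) (map enc vs) m) where

  private
    open Layout L renaming (count-at to c; ptr-at to q; contents to h)
    A = map code Zr
    p = length A
    ptr-1 : m ptr -ℤ + 1 ≡ + (base + p)
    ptr-1 = cong (_-ℤ + 1) q
    count-1 : m count -ℤ + 1 ≡ + p
    count-1 = cong (_-ℤ + 1) c
    own-cell : m (base + p) ≡ code u
    own-cell = Holds-read m A h 0 (sym (+-identityʳ p))
    cell : ∀ k → m (base + (suc k + p)) ≡ enc (at false vs k)
    cell k = trans (Holds-read m A h (suc k) (+-comm (suc k) p)) (at-map enc false vs k)
    store : ∀ y {b} → y ≡ enc b → Holds (setMem m (base + p) y) (A ʳ++ enc b ∷ map enc vs)
    store y refl = Holds-write m A y h

  dp-read : code u ≡ + 0 → verdictOf u vs ≡ at false vs 0 ∧ at false vs 1 → DpStep u Zr vs m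
  dp-read u-read verdict-u with at false vs 0 in v₀
  ... | false =
    _ , (_ , (tra-taken c refl ▸ refl ▸ refl ▸ refl ▸ iload-at {j = ptr} ptr-1 ▸ tra-not-taken (trans own-cell u-read) refl ▸
              refl ▸ refl ▸ iload-at {j = tmp} next ▸ tra-not-taken (trans (cell 0) (cong enc v₀)) refl ▸
              tra-taken next refl ▸ istore-at {i = ptr} ptr-1 ▸ refl ▸ refl ▸ done) , ≤!) ,
    layout count-1 ptr-1 (store _ (trans (cell 0) (cong enc (trans v₀ (sym verdict-u)))))
    where next : + 1 +ℤ (m ptr -ℤ + 1) ≡ + (base + suc p)
          next = cong (+ 1 +ℤ_) ptr-1
  ... | true =
    _ , (_ , (tra-taken c refl ▸ refl ▸ refl ▸ refl ▸ iload-at {j = ptr} ptr-1 ▸ tra-not-taken (trans own-cell u-read) refl ▸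
              refl ▸ refl ▸ iload-at {j = tmp} next ▸ tra-taken (trans (cell 0) (cong enc v₀)) refl ▸
              refl ▸ refl ▸ iload-at {j = tmp} next₂ ▸ tra-taken next₂ refl ▸
              istore-at {i = ptr} ptr-1 ▸ refl ▸ refl ▸ done) , ≤!) ,
    layout count-1 ptr-1 (store _ (trans (cell 1) (cong enc (sym verdict-u))))
    where next : + 1 +ℤ (m ptr -ℤ + 1) ≡ + (base + suc p)
          next = cong (+ 1 +ℤ_) ptr-1
          next₂ : + 2 +ℤ (m ptr -ℤ + 1) ≡ + (base + suc (suc p))
          next₂ = cong (+ 2 +ℤ_) ptr-1

  dp-jump : ∀ l → u ≡ jmp (suc l) → DpStep u Zr vs m
  dp-jump l refl =
    _ , (_ , (tra-taken c refl ▸ refl ▸ refl ▸ refl ▸ iload-at {j = ptr} ptr-1 ▸ tra-taken own-cell refl ▸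
              refl ▸ iload-at {j = tmp} target ▸ istore-at {i = ptr} ptr-1 ▸ refl ▸ refl ▸ done) , ≤!) ,
    layout count-1 ptr-1 (store _ (cell l))
    where target : m (base + p) +ℤ (m ptr -ℤ + 1) ≡ + (base + (suc l + p))
          target = trans (cong₂ _+ℤ_ own-cell ptr-1) (cong +_ (x∙yz≈y∙xz +-commutativeSemigroup (suc l) base p))

dp-instr : ∀ {u} → ReadOrJump u → ∀ Zr vs m → Layout (map code (u ∷ Zr)) (map enc vs) m → DpStep u Zr vs m
dp-instr (rdPos i)  Zr vs m L = dp-read {u = pos (inGet i)} Zr vs m L refl refl
dp-instr (rdNeg i)  Zr vs m L = dp-read {u = neg (inGet i)} Zr vs m L refl refl
dp-instr (jmpPos l) Zr vs m L = dp-jump Zr vs m L l refl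

dp-output : ∀ vs m → Layout [] (map enc vs) m → Reach (running (cfg 9 m haltCode [])) (halted (enc (at false vs 0) ∷ [])) 6
dp-output vs m (layout c q h) =
  _ , (tra-not-taken c refl ▸ iload-at {j = ptr} q ▸ refl ▸ refl ▸ refl ▸
       cong (λ v → halted (v ∷ [])) (trans (h 0) (at-map enc false vs 0)) ▸ done) , ≤!

dp-phase : ∀ Zr → All ReadOrJump Zr → ∀ rest m → Layout (map code Zr) (map enc (verdicts rest)) m →
           Reach (running (cfg 9 m haltCode [])) (halted (enc (verdict (Zr ʳ++ rest)) ∷ [])) (length Zr * 20 + 6)
dp-phase []       []       rest m L = dp-output (verdicts rest) m L
dp-phase (u ∷ Zr) (r ∷ rs) rest m L =
  let m₁ , reach₁ , L₁ = dp-instr r Zr (verdicts rest) m L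
  in subst (Reach _ _) (sym (+-assoc 20 (length Zr * 20) 6)) (Reach-trans reach₁ (dp-phase Zr rs (u ∷ rest) m₁ L₁))

All-ʳ++ : ∀ {P : Prim → Set} {xs ys} → All P xs → All P ys → All P (xs ʳ++ ys)
All-ʳ++ []         qs = qs
All-ʳ++ (px ∷ pxs) qs = All-ʳ++ pxs (px ∷ qs)

decider-run : ∀ Z → All ReadOrJump Z →
              Reach (initConfig (+ length (Z ++ epilogue) ∷ encodeIS (Z ++ epilogue))) (halted (enc (verdict (Z ++ epilogue)) ∷ []))
                    (2 + ((length Z * 20 + 7) + (length Z * 20 + 6)))
decider-run Z rj =
  let m₁ , reach₁ , L₁ = read-phase Z rj [] _ (layout refl refl λ _ → refl)
      reach₂ = dp-phase (Z ʳ++ []) (All-ʳ++ rj []) epilogue m₁ L₁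
  in Reach-trans prologue (Reach-trans reach₁
       (subst₂ (λ X t → Reach (running (cfg 9 m₁ haltCode [])) (halted (enc (verdict X) ∷ [])) (t * 20 + 6))
               (ʳ++-ʳ++ Z) (length-reverse Z) reach₂))
  where prologue : Reach _ _ 2
        prologue = _ , (refl ▸ refl ▸ done) , ≤!

decider-time : ∀ Z → 2 + ((length Z * 20 + 7) + (length Z * 20 + 6)) ≤ 40 * length (Z ++ epilogue)
decider-time Z = begin
  2 + ((length Z * 20 + 7) + (length Z * 20 + 6))        ≤⟨ m≤m+n _ 65 ⟩
  2 + ((length Z * 20 + 7) + (length Z * 20 + 6)) + 65   ≡⟨ arithmetic (length Z) ⟩
  40 * (length Z + 2)                                     ≡⟨ cong (40 *_) (length-++ Z) ⟨
  40 * length (Z ++ epilogue)                             ∎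
  where
    open ≤-Reasoning
    arithmetic : ∀ L → 2 + ((L * 20 + 7) + (L * 20 + 6)) + 65 ≡ 40 * (L + 2)
    arithmetic = solve-∀

decider-halts : ∀ {X} → Good X → HaltsWithin decider (+ length X ∷ encodeIS X) (40 * length X) (enc (verdict X) ∷ [])
decider-halts (Z , rj , refl) = Reach⇒HaltsWithin (decider-run Z rj) (decider-time Z)

lemma4 : ∃₂ λ (P : Program) (c : ℕ) →
           (n : ℕ) → 1 ≤ n → (X : InstrSeq) → VeryGood X → length X ≡ n →
           ∃ λ (b : Bool) →
             HaltsWithin P (+ n ∷ encodeIS X) (c * n) ((if b then + 1 else + 0) ∷ [])
             × (b ≡ true ⇔ AlwaysOne X)
lemma4 = decider , 40 , λ { _ _ X very-good@(good , _) refl →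
  verdict X , decider-halts good , verdict⇔AlwaysOne very-good }
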